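{- Let $p_1=2<p_2=3<p_3=5<\cdots$ be the sequence of all primes. Then $2^{i}p_i$ is a Zumkeller number for every $i>1$.
   Context: A positive integer $n$ is a Zumkeller number if the set of its positive divisors can be partitioned into two disjoint subsets with equal sums. -}

module Defs where

open import Data.Bool using (Bool; true; false; if_then_else_)
open import Data.Nat using (ℕ; zero; suc; _+_; _*_; _^_; _<_)
open import Data.Nat.Divisibility using (_∣?_)
open import Data.Nat.Primality using (Prime; prime?)
open import Data.List using (List; applyUpTo; filter; map; length; upTo)
open import Data.Nat.ListAction using (sum)
open import Data.Product using (Σ; _×_)
open import Relation.Binary.PropositionalEquality using (_≡_)

divisors : ℕ → List ℕ
divisors n = filter (_∣? n) (applyUpTo suc n)

sumWhere : (ℕ → Bool) → List ℕ → ℕ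
sumWhere c xs = sum (map (λ d → if c d then d else 0) xs)

sumWhereNot : (ℕ → Bool) → List ℕ → ℕ
sumWhereNot c xs = sum (map (λ d → if c d then 0 else d) xs)

-- n is Zumkeller: the set of its positive divisors splits into two disjoint
-- subsets (those coloured true / false by c) with equal sums.
Zumkeller : ℕ → Set
Zumkeller n = Σ (ℕ → Bool) λ c → sumWhere c (divisors n) ≡ sumWhereNot c (divisors n)

primesBelow : ℕ → ℕ
primesBelow p = length (filter prime? (upTo p))

-- p is the i-th prime (1-indexed: p₁ = 2, p₂ = 3, …)
IsIthPrime : ℕ → ℕ → Set
IsIthPrime i p = Prime p × suc (primesBelow p) ≡ i

module Submission where

-- For i > 1 the i-th prime p is odd, say p = 2q + 1, and p < 2^(i+1).  For such p the divisors
-- of 2^i p are the powers 2^j and the multiples 2^j p (j ≤ i), and σ(2^i p) = (2^(i+1) - 1)(p + 1).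
-- A colouring with half of σ on its true side is: the multiples 2^j p with j < i, summing to
-- (2^i - 1) p, together with the powers of two in the binary expansion of b = 2^i + q, which
-- exist because b < 2^(i+1).
--
-- The bound p_i < 2^(i+1) comes from a
-- Chebyshev-type estimate 2^n ≤ (n+1)^π(n+1): by Leibniz's harmonic triangle every positive common
-- multiple of 1, …, n+1 is at least 2^n, while the product of the largest prime powers ≤ n+1 is
-- such a common multiple and is at most (n+1)^π(n+1).

open import Defs
open import Data.Bool using (Bool; true; false; if_then_else_)
open import Data.Nat
open import Data.Nat.Properties
open import Data.Nat.Divisibility
open import Data.Nat.DivMod using (_/_; _%_; m≡m%n+[m/n]*n; m%n<n; /-congʳ; m<n⇒m/n≡0; m/n/o≡m/[n*o]; n/1≡n)
open import Data.Nat.Primality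
open import Data.Nat.Coprimality using (Coprime; coprime-divisor)
open import Data.Nat.ListAction using (sum; product)
open import Data.Nat.Induction using (<-rec)
open import Data.Nat.Primality.Factorisation using (factorise)
open import Data.Nat.ListAction.Properties using (sum-++; sum-↭)
open import Data.Nat.Tactic.RingSolver using (solve-∀)
open import Data.List using (List; []; _∷_; _++_; map; filter; length; applyUpTo; applyDownFrom; upTo)
open import Data.List.Membership.Propositional using (_∈_)
open import Data.List.Membership.Propositional.Properties
  using (∈-filter⁺; ∈-filter⁻; ∈-applyUpTo⁺; ∈-upTo⁺; ∈-applyDownFrom⁺; ∈-applyDownFrom⁻; ∈-map⁺; ∈-map⁻; ∈-++⁺ˡ; ∈-++⁺ʳ; ∈-++⁻)
open import Data.List.Membership.Propositional.Properties.WithK using (unique∧set⇒bag)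
open import Data.List.Relation.Binary.BagAndSetEquality using (∼bag⇒↭)
open import Data.List.Relation.Binary.Permutation.Propositional using (_↭_)
import Data.List.Relation.Binary.Permutation.Propositional.Properties as ↭
open import Data.List.Properties using (map-++; map-cong-local; map-id-local; filter-++; length-++-≤ˡ; upTo-∷ʳ)
import Data.List.Relation.Unary.All.Properties as All
open import Data.List.Relation.Unary.Any using (here; there)
open import Data.List.Relation.Unary.All using (All; []; _∷_)
open import Data.List.Relation.Unary.Unique.Propositional using (Unique)
import Data.List.Relation.Unary.Unique.Propositional.Properties as Unique
open import Data.Product using (_,_; _×_; ∃; proj₂)
open import Data.Sum using (_⊎_; inj₁; inj₂)
open import Function.Bundles using (_⇔_; mk⇔; Equivalence)
open import Relation.Nullary using (¬_; does; yes; no; contradiction)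
open import Relation.Nullary.Decidable using (dec-true; dec-false; toWitness)
open import Relation.Binary.PropositionalEquality

private
  variable
    d e j k m n p r : ℕ

sumWhere+sumWhereNot : ∀ c xs → sumWhere c xs + sumWhereNot c xs ≡ sum xs
sumWhere+sumWhereNot c [] = refl
sumWhere+sumWhereNot c (x ∷ xs) with c x
... | true  = trans (+-assoc x _ _) (cong (x +_) (sumWhere+sumWhereNot c xs))
... | false = trans (swap (sumWhere c xs) x _) (cong (x +_) (sumWhere+sumWhereNot c xs))
  where
  swap : ∀ a b c → a + (b + c) ≡ b + (a + c)
  swap = solve-∀

zumkeller-if-half : ∀ n c → 2 * sumWhere c (divisors n) ≡ sum (divisors n) → Zumkeller n
zumkeller-if-half n c half = c , +-cancelˡ-≡ W W W' (begin
    W + W    ≡⟨ cong (W +_) (sym (+-identityʳ W)) ⟩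
    2 * W    ≡⟨ half ⟩
    sum ds   ≡⟨ sumWhere+sumWhereNot c ds ⟨
    W + W'   ∎)
  where
  open ≡-Reasoning
  ds = divisors n
  W  = sumWhere c ds
  W' = sumWhereNot c ds

sameMembers⇒↭ : ∀ {xs ys : List ℕ} → Unique xs → Unique ys → (∀ {x} → x ∈ xs ⇔ x ∈ ys) → xs ↭ ys
sameMembers⇒↭ uxs uys same = ∼bag⇒↭ (unique∧set⇒bag uxs uys same)

divisors-unique : ∀ n → Unique (divisors n)
divisors-unique n = Unique.filter⁺ (_∣? n) (Unique.applyUpTo⁺₁ suc n (λ i<j _ eq → <⇒≢ i<j (suc-injective eq)))

∈-divisors : .{{NonZero n}} → d ∈ divisors n ⇔ d ∣ n
∈-divisors {n} = mk⇔ (λ d∈ → proj₂ (∈-filter⁻ (_∣? n) {xs = applyUpTo suc n} d∈)) member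
  where
  member : d ∣ n → d ∈ divisors n
  member {zero}   d∣n = contradiction (0∣⇒≡0 d∣n) (≢-nonZero⁻¹ n)
  member {suc d′} d∣n = ∈-filter⁺ (_∣? n) (∈-applyUpTo⁺ suc (∣⇒≤ d∣n)) d∣n

prime>1 : Prime p → 1 < p
prime>1 {p} pp = nonTrivial⇒n>1 p {{prime⇒nonTrivial pp}}

^-monoʳ-∣ : ∀ r → j ≤ k → r ^ j ∣ r ^ k
^-monoʳ-∣ {j} {k} r j≤k = divides (r ^ (k ∸ j)) (begin
    r ^ k             ≡⟨ cong (r ^_) (m∸n+n≡m j≤k) ⟨
    r ^ (k ∸ j + j)   ≡⟨ ^-distribˡ-+-* r (k ∸ j) j ⟩
    r ^ (k ∸ j) * r ^ j ∎)
  where open ≡-Reasoning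

¬∣⇒coprime : Prime p → ¬ p ∣ d → Coprime d p
¬∣⇒coprime pp p∤d (c∣d , c∣p) with prime⇒irreducible pp c∣p
... | inj₁ c≡1  = c≡1
... | inj₂ refl = contradiction c∣d p∤d

prime∤prime^ : Prime p → Prime r → p ≢ r → ¬ p ∣ r ^ k
prime∤prime^ {k = zero}  pp _  _   p∣1 = <⇒≢ (prime>1 pp) (sym (∣1⇒≡1 p∣1))
prime∤prime^ {r = r} {k = suc k} pp pr p≢r p∣r^k+1 with euclidsLemma r (r ^ k) pp p∣r^k+1
... | inj₂ p∣r^k = prime∤prime^ {k = k} pp pr p≢r p∣r^k
... | inj₁ p∣r with prime⇒irreducible pr p∣r
...   | inj₁ p≡1 = <⇒≢ (prime>1 pp) (sym p≡1)
...   | inj₂ p≡r = p≢r p≡r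

∣prime^⇒power : Prime r → d ∣ r ^ k → ∃ λ j → j ≤ k × d ≡ r ^ j
∣prime^⇒power {k = zero} pr d∣1 = 0 , z≤n , ∣1⇒≡1 d∣1
∣prime^⇒power {r} {d} {suc k} pr d∣r^k+1 with r ∣? d
... | no r∤d with j , j≤k , refl ← ∣prime^⇒power {k = k} pr (coprime-divisor (¬∣⇒coprime pr r∤d) d∣r^k+1)
  = j , m≤n⇒m≤1+n j≤k , refl
... | yes (divides e refl) = raise (∣prime^⇒power {k = k} pr e∣r^k)
  where
  e∣r^k : e ∣ r ^ k
  e∣r^k = *-cancelʳ-∣ r {{prime⇒nonZero pr}} (subst (e * r ∣_) (*-comm r (r ^ k)) d∣r^k+1)
  raise : (∃ λ j → j ≤ k × e ≡ r ^ j) → ∃ λ j → j ≤ suc k × e * r ≡ r ^ j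
  raise (j , j≤k , refl) = suc j , s≤s j≤k , *-comm (r ^ j) r

∣*prime : Prime p → d ∣ m * p → d ∣ m ⊎ ∃ λ e → e ∣ m × d ≡ e * p
∣*prime {p} {d} {m} pp d∣mp with p ∣? d
... | yes (divides e refl) = inj₂ (e , *-cancelʳ-∣ p {{prime⇒nonZero pp}} d∣mp , refl)
... | no p∤d = inj₁ (coprime-divisor (¬∣⇒coprime pp p∤d) (subst (d ∣_) (*-comm m p) d∣mp))

powers : ℕ → ℕ → List ℕ
powers r = applyDownFrom (r ^_)

divisorList : ℕ → ℕ → ℕ → List ℕ
divisorList r p k = powers r k ++ map (_* p) (powers r k)

∈-divisorList : Prime r → Prime p → d ∈ divisorList r p (suc k) ⇔ d ∣ r ^ k * p
∈-divisorList {r} {p} {d} {k} pr pp = mk⇔ divides-of-member member-of-divides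
  where
  power∣ : ∀ {j} → j < suc k → r ^ j ∣ r ^ k
  power∣ j<k+1 = ^-monoʳ-∣ r (s≤s⁻¹ j<k+1)
  divides-of-member : d ∈ divisorList r p (suc k) → d ∣ r ^ k * p
  divides-of-member d∈ with ∈-++⁻ (powers r (suc k)) d∈
  ... | inj₁ d∈powers with j , j<k+1 , refl ← ∈-applyDownFrom⁻ (r ^_) d∈powers
    = ∣-trans (power∣ j<k+1) (m∣m*n {r ^ k} p)
  ... | inj₂ d∈p*powers with ∈-map⁻ (_* p) {xs = powers r (suc k)} d∈p*powers
  ...   | e , e∈powers , refl with j , j<k+1 , refl ← ∈-applyDownFrom⁻ (r ^_) e∈powers
    = *-monoˡ-∣ p (power∣ j<k+1)
  member-of-divides : d ∣ r ^ k * p → d ∈ divisorList r p (suc k)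
  member-of-divides d∣ with ∣*prime {m = r ^ k} pp d∣
  ... | inj₁ d∣r^k with j , j≤k , refl ← ∣prime^⇒power {k = k} pr d∣r^k
    = ∈-++⁺ˡ (∈-applyDownFrom⁺ (r ^_) (s≤s j≤k))
  ... | inj₂ (e , e∣r^k , refl) with j , j≤k , refl ← ∣prime^⇒power {k = k} pr e∣r^k
    = ∈-++⁺ʳ (powers r (suc k)) (∈-map⁺ (_* p) (∈-applyDownFrom⁺ (r ^_) (s≤s j≤k)))

-- No entry of divisorList is repeated, since p never divides a power of r.
divisorList-unique : Prime r → Prime p → p ≢ r → Unique (divisorList r p k)
divisorList-unique {r} {p} {k} pr pp p≢r =
  Unique.++⁺ powers-unique (Unique.map⁺ (λ {x} {y} → *-cancelʳ-≡ x y p {{prime⇒nonZero pp}}) powers-unique) disjoint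
  where
  powers-unique : Unique (powers r k)
  powers-unique = Unique.applyDownFrom⁺₁ (r ^_) k (λ j<i _ eq → <⇒≢ (^-monoʳ-< r (prime>1 pr) j<i) (sym eq))
  disjoint : ∀ {v} → ¬ (v ∈ powers r k × v ∈ map (_* p) (powers r k))
  disjoint (v∈powers , v∈p*powers) with ∈-applyDownFrom⁻ (r ^_) v∈powers | ∈-map⁻ (_* p) v∈p*powers
  ... | a , _ , refl | e , _ , r^a≡e*p = prime∤prime^ {k = a} pp pr p≢r (divides e r^a≡e*p)

divisors↭divisorList : Prime r → Prime p → p ≢ r → divisors (r ^ k * p) ↭ divisorList r p (suc k)
divisors↭divisorList {r} {p} {k} pr pp p≢r =
  sameMembers⇒↭ (divisors-unique (r ^ k * p)) (divisorList-unique {k = suc k} pr pp p≢r)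
    (mk⇔ (λ d∈ → Equivalence.from (∈-divisorList {k = k} pr pp) (Equivalence.to ∈-divisors d∈))
         (λ d∈ → Equivalence.from ∈-divisors (Equivalence.to (∈-divisorList {k = k} pr pp) d∈)))
  where
  instance
    r^k*p≢0 : NonZero (r ^ k * p)
    r^k*p≢0 = m*n≢0 (r ^ k) p {{m^n≢0 r k {{prime⇒nonZero pr}}}} {{prime⇒nonZero pp}}

sum-powers2 : ∀ k → suc (sum (powers 2 k)) ≡ 2 ^ k
sum-powers2 zero    = refl
sum-powers2 (suc k) = begin
    suc (2 ^ k + sum (powers 2 k)) ≡⟨ +-suc (2 ^ k) _ ⟨
    2 ^ k + suc (sum (powers 2 k)) ≡⟨ cong (2 ^ k +_) (sum-powers2 k) ⟩
    2 ^ k + 2 ^ k                  ≡⟨ cong (2 ^ k +_) (+-identityʳ (2 ^ k)) ⟨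
    2 ^ suc k                      ∎
  where open ≡-Reasoning

sum-map-*ʳ : ∀ m xs → sum (map (_* m) xs) ≡ sum xs * m
sum-map-*ʳ m []       = refl
sum-map-*ʳ m (x ∷ xs) = trans (cong (x * m +_) (sum-map-*ʳ m xs)) (sym (*-distribʳ-+ m x (sum xs)))

-- Division made total (m ÷ 0 = 0), so that it can be applied to any list entry.
infixl 7 _÷_
_÷_ : ℕ → ℕ → ℕ
m ÷ zero    = 0
m ÷ (suc k) = m / suc k

÷-halve : ∀ m n → (m ÷ n) / 2 ≡ m ÷ (2 * n)
÷-halve m zero    = refl
÷-halve m (suc n) = trans (m/n/o≡m/[n*o] m (suc n) 2) (/-congʳ {m = m} (*-comm (suc n) 2))

<⇒÷≡0 : m < n → m ÷ n ≡ 0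
<⇒÷≡0 {n = suc n} m<n = m<n⇒m/n≡0 m<n

digitAt : ℕ → ℕ → Bool
digitAt b d = (b ÷ d) % 2 ≡ᵇ 1

digitPart : ℕ → ℕ → ℕ
digitPart b d = if digitAt b d then d else 0

digitPart≡ : ∀ b d → digitPart b d ≡ (b ÷ d) % 2 * d
digitPart≡ b d with (b ÷ d) % 2 | m%n<n (b ÷ d) 2
... | 0 | _ = refl
... | 1 | _ = sym (+-identityʳ d)
... | suc (suc _) | s≤s (s≤s ())

binaryExpansion : ∀ b k → sum (map (digitPart b) (powers 2 k)) + 2 ^ k * (b ÷ 2 ^ k) ≡ b
binaryExpansion b zero = trans (+-identityʳ (b / 1)) (n/1≡n b)
binaryExpansion b (suc k) = begin
    digitPart b (2 ^ k) + S + 2 ^ suc k * (b ÷ 2 ^ suc k)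
      ≡⟨ cong₂ (λ u v → u + S + 2 ^ suc k * v) (digitPart≡ b (2 ^ k)) (sym (÷-halve b (2 ^ k))) ⟩
    x % 2 * 2 ^ k + S + 2 ^ suc k * (x / 2)  ≡⟨ regroup (x % 2) (2 ^ k) S (x / 2) ⟩
    S + 2 ^ k * (x % 2 + x / 2 * 2)          ≡⟨ cong (λ y → S + 2 ^ k * y) (m≡m%n+[m/n]*n x 2) ⟨
    S + 2 ^ k * x                            ≡⟨ binaryExpansion b k ⟩
    b                                        ∎
  where
  open ≡-Reasoning
  S = sum (map (digitPart b) (powers 2 k))
  x = b ÷ 2 ^ k
  regroup : ∀ r t s h → r * t + s + (2 * t) * h ≡ s + t * (r + h * 2)
  regroup = solve-∀

binaryExpansion-< : ∀ {b} k → b < 2 ^ k → sum (map (digitPart b) (powers 2 k)) ≡ b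
binaryExpansion-< {b} k b<2^k = begin
    S                          ≡⟨ +-identityʳ S ⟨
    S + 0                      ≡⟨ cong (S +_) (*-zeroʳ (2 ^ k)) ⟨
    S + 2 ^ k * 0              ≡⟨ cong (λ y → S + 2 ^ k * y) (<⇒÷≡0 b<2^k) ⟨
    S + 2 ^ k * (b ÷ 2 ^ k)    ≡⟨ binaryExpansion b k ⟩
    b                          ∎
  where
  open ≡-Reasoning
  S = sum (map (digitPart b) (powers 2 k))

-- The true side takes the multiples 2^j * p with j < i, summing to (2^i - 1) p, and
-- the powers of two given by the binary digits of b = 2^i + q, summing to b (as b < 2^(i+1)).
-- This is exactly half of σ(2^i p) = (2^(i+1) - 1)(p + 1).
module OddPrimeTimesPowerOfTwo {i p q : ℕ} (pp : Prime p) (p≡ : p ≡ 1 + q * 2) (p<2^i+1 : p < 2 ^ suc i) where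

  private instance
    p≢0 : NonZero p
    p≢0 = prime⇒nonZero pp

  -- The number whose binary digits select the powers of two on the true side.
  b : ℕ
  b = 2 ^ i + q

  colour : ℕ → Bool
  colour d = if does (p ∣? d) then does (d <? 2 ^ i * p) else digitAt b d

  side : ℕ → ℕ
  side d = if colour d then d else 0

  p≢2 : p ≢ 2
  p≢2 p≡2 = odd≢2 q (trans (sym p≡) p≡2)
    where
    odd≢2 : ∀ q → 1 + q * 2 ≢ 2
    odd≢2 zero    ()
    odd≢2 (suc q) ()

  b<2^i+1 : b < 2 ^ suc i
  b<2^i+1 = subst (b <_) (cong (2 ^ i +_) (sym (+-identityʳ (2 ^ i)))) (+-monoʳ-< (2 ^ i) q<2^i)
    where
    q<2^i : q < 2 ^ i
    q<2^i = *-cancelʳ-≤ (suc q) (2 ^ i) 2 (subst₂ _≤_ (cong suc p≡) (*-comm 2 (2 ^ i)) p<2^i+1)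

  side-powers : sum (map side (powers 2 (suc i))) ≡ b
  side-powers = trans (cong sum (map-cong-local (All.applyDownFrom⁺₁ (2 ^_) (suc i) (λ {j} _ → on-power j))))
                      (binaryExpansion-< (suc i) b<2^i+1)
    where
    on-power : ∀ j → side (2 ^ j) ≡ digitPart b (2 ^ j)
    on-power j rewrite dec-false (p ∣? 2 ^ j) (prime∤prime^ {k = j} pp prime[2] p≢2) = refl

  side-multiples : sum (map side (map (_* p) (powers 2 (suc i)))) ≡ sum (powers 2 i) * p
  side-multiples = begin
      side (2 ^ i * p) + sum (map side (map (_* p) (powers 2 i))) ≡⟨ cong₂ _+_ top-excluded (cong sum lower-included) ⟩
      sum (map (_* p) (powers 2 i))                              ≡⟨ sum-map-*ʳ p (powers 2 i) ⟩
      sum (powers 2 i) * p                                        ∎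
    where
    open ≡-Reasoning
    p∣2^j*p : ∀ j → p ∣ 2 ^ j * p
    p∣2^j*p j = n∣m*n (2 ^ j)
    top-excluded : side (2 ^ i * p) ≡ 0
    top-excluded rewrite dec-true (p ∣? 2 ^ i * p) (p∣2^j*p i)
                       | dec-false (2 ^ i * p <? 2 ^ i * p) (<-irrefl refl) = refl
    on-multiple : ∀ {j} → j < i → side (2 ^ j * p) ≡ 2 ^ j * p
    on-multiple {j} j<i rewrite dec-true (p ∣? 2 ^ j * p) (p∣2^j*p j)
      | dec-true (2 ^ j * p <? 2 ^ i * p) (*-monoˡ-< p (^-monoʳ-< 2 (s≤s (s≤s z≤n)) j<i)) = refl
    lower-included : map side (map (_* p) (powers 2 i)) ≡ map (_* p) (powers 2 i)
    lower-included = map-id-local (All.map⁺ (All.applyDownFrom⁺₁ (2 ^_) i on-multiple))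

  divisors↭ : divisors (2 ^ i * p) ↭ divisorList 2 p (suc i)
  divisors↭ = divisors↭divisorList prime[2] pp p≢2

  trueSide : sumWhere colour (divisors (2 ^ i * p)) ≡ b + sum (powers 2 i) * p
  trueSide = begin
      sum (map side (divisors (2 ^ i * p)))                 ≡⟨ sum-↭ (↭.map⁺ side divisors↭) ⟩
      sum (map side (divisorList 2 p (suc i)))              ≡⟨ cong sum (map-++ side (powers 2 (suc i)) _) ⟩
      sum (map side (powers 2 (suc i)) ++ map side (map (_* p) (powers 2 (suc i))))
                                                            ≡⟨ sum-++ (map side (powers 2 (suc i))) _ ⟩
      sum (map side (powers 2 (suc i))) + sum (map side (map (_* p) (powers 2 (suc i))))
                                                            ≡⟨ cong₂ _+_ side-powers side-multiples ⟩
      b + sum (powers 2 i) * p                              ∎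
    where open ≡-Reasoning

  -- σ(2^i p) = (2^(i+1) - 1)(p + 1), with 2^(i+1) - 1 written as a sum of powers of two.
  σ : sum (divisors (2 ^ i * p)) ≡ sum (powers 2 (suc i)) + sum (powers 2 (suc i)) * p
  σ = begin
      sum (divisors (2 ^ i * p))                                   ≡⟨ sum-↭ divisors↭ ⟩
      sum (powers 2 (suc i) ++ map (_* p) (powers 2 (suc i)))      ≡⟨ sum-++ (powers 2 (suc i)) _ ⟩
      sum (powers 2 (suc i)) + sum (map (_* p) (powers 2 (suc i))) ≡⟨ cong (sum (powers 2 (suc i)) +_) (sum-map-*ʳ p (powers 2 (suc i))) ⟩
      sum (powers 2 (suc i)) + sum (powers 2 (suc i)) * p          ∎
    where open ≡-Reasoning

  -- With 2^i = g + 1 (g = 2^i - 1) and p = 2q + 1, both sides equal 2 (2g + 1)(q + 1).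
  halves : 2 * (b + sum (powers 2 i) * p) ≡ sum (powers 2 (suc i)) + sum (powers 2 (suc i)) * p
  halves rewrite p≡ | sym (sum-powers2 i) = identity (sum (powers 2 i)) q
    where
    identity : ∀ g q → 2 * (suc g + q + g * (1 + q * 2)) ≡ suc g + g + (suc g + g) * (1 + q * 2)
    identity = solve-∀

  zumkeller : Zumkeller (2 ^ i * p)
  zumkeller = zumkeller-if-half (2 ^ i * p) colour (trans (cong (2 *_) trueSide) (trans halves (sym σ)))

choose : ℕ → ℕ → ℕ
choose n       zero    = 1
choose zero    (suc k) = 0
choose (suc n) (suc k) = choose n k + choose n (suc k)

choose-pos : k ≤ n → 0 < choose n k
choose-pos {zero}  _   = s≤s z≤n
choose-pos {suc k} {suc n} k<n = ≤-trans (choose-pos {k} {n} (s≤s⁻¹ k<n)) (m≤m+n _ _)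

choose-zero : n < k → choose n k ≡ 0
choose-zero {zero}  {suc k} _ = refl
choose-zero {suc n} {suc k} n<k
  rewrite choose-zero {n} {k} (s≤s⁻¹ n<k) | choose-zero {n} {suc k} (m<n⇒m<1+n (s≤s⁻¹ n<k)) = refl

choose-1 : ∀ n → choose n 1 ≡ n
choose-1 zero    = refl
choose-1 (suc n) = cong suc (choose-1 n)

choose-absorb : ∀ m k → suc k * choose (suc m) (suc k) ≡ suc m * choose m k
choose-absorb m zero = trans (*-identityˡ _) (trans (choose-1 (suc m)) (sym (*-identityʳ (suc m))))
choose-absorb zero    (suc k) = *-zeroʳ (suc (suc k))
choose-absorb (suc m) (suc k) = begin
    suc (suc k) * (u + v)                                ≡⟨ *-distribˡ-+ (suc (suc k)) u v ⟩
    suc (suc k) * u + suc (suc k) * v                    ≡⟨ cong (suc (suc k) * u +_) (choose-absorb m (suc k)) ⟩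
    suc (suc k) * u + suc m * choose m (suc k)           ≡⟨ cong (λ z → u + z + suc m * choose m (suc k)) (choose-absorb m k) ⟩
    u + suc m * choose m k + suc m * choose m (suc k)    ≡⟨ +-assoc u _ _ ⟩
    u + (suc m * choose m k + suc m * choose m (suc k))  ≡⟨ cong (u +_) (*-distribˡ-+ (suc m) (choose m k) _) ⟨
    suc (suc m) * u                                      ∎
  where
  open ≡-Reasoning
  u = choose (suc m) (suc k)
  v = choose (suc m) (suc (suc k))

-- Denominators of Leibniz's harmonic triangle: L(n, k) = (n+1) C(n, k).
leibniz : ℕ → ℕ → ℕ
leibniz n k = suc n * choose n k

leibniz-pos : k ≤ n → 0 < leibniz n k
leibniz-pos {k} {n} k≤n = *-mono-< {0} {suc n} {0} (s≤s z≤n) (choose-pos k≤n)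

-- Leibniz's rule 1/L(n+1, k+1) = 1/L(n, k) - 1/L(n+1, k), with denominators cleared.
leibniz-rule : ∀ n k → leibniz (suc n) k * leibniz (suc n) (suc k)
                       ≡ leibniz n k * (leibniz (suc n) k + leibniz (suc n) (suc k))
leibniz-rule n k = *-cancelˡ-≡ (d₂ * d₃) (d₁ * (d₂ + d₃)) (suc k) (begin
    suc k * (d₂ * d₃)                                             ≡⟨ rearrange₁ (suc k) d₂ (2 + n) (choose (suc n) (suc k)) ⟩
    d₂ * ((2 + n) * (suc k * choose (suc n) (suc k)))             ≡⟨ cong (λ z → d₂ * ((2 + n) * z)) (choose-absorb n k) ⟩
    d₂ * ((2 + n) * d₁)                                           ≡⟨ rearrange₂ d₂ (2 + n) d₁ ⟩
    d₁ * ((2 + n) * d₂)                                           ≡⟨ cong (λ z → d₁ * ((2 + n) * z)) (choose-absorb (suc n) k) ⟨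
    d₁ * ((2 + n) * (suc k * choose (2 + n) (suc k)))             ≡⟨ rearrange₃ d₁ (2 + n) (suc k) (choose (suc n) k) (choose (suc n) (suc k)) ⟩
    suc k * (d₁ * (d₂ + d₃))                                      ∎)
  where
  open ≡-Reasoning
  d₁ = leibniz n k
  d₂ = leibniz (suc n) k
  d₃ = leibniz (suc n) (suc k)
  rearrange₁ : ∀ a b c x → a * (b * (c * x)) ≡ b * (c * (a * x))
  rearrange₁ = solve-∀
  rearrange₂ : ∀ a c b → a * (c * b) ≡ b * (c * a)
  rearrange₂ = solve-∀
  rearrange₃ : ∀ d c a u v → d * (c * (a * (u + v))) ≡ a * (d * (c * u + c * v))
  rearrange₃ = solve-∀

-- If 1/d₃ = 1/d₁ - 1/d₂ (i.e. d₂ d₃ = d₁ (d₂ + d₃)) then every common multiple of d₁ and d₂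
-- is a multiple of d₃: M/d₃ = M/d₁ - M/d₂.
∣-reciprocalDifference : ∀ {M d₁ d₂ d₃} .{{_ : NonZero d₁}} .{{_ : NonZero d₂}} →
  d₂ * d₃ ≡ d₁ * (d₂ + d₃) → d₁ ∣ M → d₂ ∣ M → d₃ ∣ M
∣-reciprocalDifference {M} {d₁} {d₂} {d₃} rule (divides x M≡x*d₁) (divides y M≡y*d₂) =
  divides (x ∸ y) (sym (begin
    (x ∸ y) * d₃         ≡⟨ *-distribʳ-∸ d₃ x y ⟩
    x * d₃ ∸ y * d₃      ≡⟨ cong (_∸ y * d₃) x*d₃≡ ⟩
    M + y * d₃ ∸ y * d₃  ≡⟨ m+n∸n≡m M (y * d₃) ⟩
    M                    ∎))
  where
  open ≡-Reasoning
  instance _ = m*n≢0 d₁ d₂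
  x*d₃≡ : x * d₃ ≡ M + y * d₃
  x*d₃≡ = *-cancelʳ-≡ (x * d₃) (M + y * d₃) (d₁ * d₂) (begin
    x * d₃ * (d₁ * d₂)              ≡⟨ rearrange₁ x d₃ d₁ d₂ ⟩
    x * d₁ * (d₂ * d₃)              ≡⟨ cong₂ _*_ (sym M≡x*d₁) rule ⟩
    M * (d₁ * (d₂ + d₃))            ≡⟨ rearrange₂ M d₁ d₂ d₃ ⟩
    M * (d₁ * d₂) + M * d₁ * d₃     ≡⟨ cong (λ z → M * (d₁ * d₂) + z * d₁ * d₃) M≡y*d₂ ⟩
    M * (d₁ * d₂) + y * d₂ * d₁ * d₃ ≡⟨ rearrange₃ M y d₁ d₂ d₃ ⟩
    (M + y * d₃) * (d₁ * d₂)        ∎)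
    where
    rearrange₁ : ∀ x c a b → x * c * (a * b) ≡ x * a * (b * c)
    rearrange₁ = solve-∀
    rearrange₂ : ∀ m a b c → m * (a * (b + c)) ≡ m * (a * b) + m * a * c
    rearrange₂ = solve-∀
    rearrange₃ : ∀ m y a b c → m * (a * b) + y * b * a * c ≡ (m + y * c) * (a * b)
    rearrange₃ = solve-∀

CommonMultiple : ℕ → ℕ → Set
CommonMultiple N M = ∀ {j} → 0 < j → j ≤ N → j ∣ M

leibniz∣ : ∀ {M} n → CommonMultiple (suc n) M → ∀ {k} → k ≤ n → leibniz n k ∣ M
leibniz∣ {M} n multiple {zero} _ = subst (_∣ M) (sym (*-identityʳ (suc n))) (multiple (s≤s z≤n) ≤-refl)
leibniz∣ (suc n) multiple {suc k} k<n =
  ∣-reciprocalDifference {{>-nonZero (leibniz-pos k≤n)}} {{>-nonZero (leibniz-pos k≤n+1)}} (leibniz-rule n k)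
    (leibniz∣ n (λ 0<j j≤n+1 → multiple 0<j (m≤n⇒m≤1+n j≤n+1)) k≤n)
    (leibniz∣ (suc n) multiple k≤n+1)
  where
  k≤n = s≤s⁻¹ k<n
  k≤n+1 = m≤n⇒m≤1+n k≤n

rowSum : ℕ → ℕ → ℕ
rowSum n zero    = 0
rowSum n (suc K) = rowSum n K + choose n K

rowSum-pascal : ∀ n K → rowSum (suc n) (suc K) ≡ rowSum n (suc K) + rowSum n K
rowSum-pascal n zero    = refl
rowSum-pascal n (suc K) rewrite rowSum-pascal n K = regroup (rowSum n K) (choose n K) (choose n (suc K))
  where
  regroup : ∀ r a b → r + a + r + (a + b) ≡ r + a + b + (r + a)
  regroup = solve-∀

rowSum-full : ∀ n → rowSum n (suc n) ≡ 2 ^ n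
rowSum-full zero    = refl
rowSum-full (suc n) = begin
    rowSum (suc n) (2 + n)                  ≡⟨ rowSum-pascal n (suc n) ⟩
    rowSum n (2 + n) + rowSum n (suc n)     ≡⟨ cong (λ z → rowSum n (suc n) + z + rowSum n (suc n)) (choose-zero {n} {suc n} ≤-refl) ⟩
    rowSum n (suc n) + 0 + rowSum n (suc n) ≡⟨ cong₂ (λ u v → u + 0 + v) (rowSum-full n) (trans (rowSum-full n) (sym (+-identityʳ (2 ^ n)))) ⟩
    2 ^ n + 0 + (2 ^ n + 0)                 ≡⟨ cong (_+ (2 ^ n + 0)) (+-identityʳ (2 ^ n)) ⟩
    2 ^ suc n                               ∎
  where open ≡-Reasoning

rowSum-bound : ∀ {M} n → (∀ {k} → k ≤ n → leibniz n k ≤ M) → ∀ {K} → K ≤ suc n → suc n * rowSum n K ≤ K * M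
rowSum-bound n bound {zero}  _ = ≤-reflexive (*-zeroʳ (suc n))
rowSum-bound {M} n bound {suc K} K<n+1 = begin
    suc n * (rowSum n K + choose n K)           ≡⟨ *-distribˡ-+ (suc n) (rowSum n K) (choose n K) ⟩
    suc n * rowSum n K + leibniz n K            ≤⟨ +-mono-≤ (rowSum-bound n bound (<⇒≤ K<n+1)) (bound (s≤s⁻¹ K<n+1)) ⟩
    K * M + M                                   ≡⟨ +-comm (K * M) M ⟩
    suc K * M                                   ∎
  where open ≤-Reasoning

commonMultiple≥2^ : ∀ {M} n → 0 < M → CommonMultiple (suc n) M → 2 ^ n ≤ M
commonMultiple≥2^ {M} n 0<M multiple = *-cancelˡ-≤ (suc n) (begin
    suc n * 2 ^ n              ≡⟨ cong (suc n *_) (rowSum-full n) ⟨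
    suc n * rowSum n (suc n)   ≤⟨ rowSum-bound n (λ k≤n → ∣⇒≤ {{>-nonZero 0<M}} (leibniz∣ n multiple k≤n)) ≤-refl ⟩
    suc n * M                  ∎)
  where open ≤-Reasoning

n<r^n : 1 < r → ∀ n → n < r ^ n
n<r^n 1<r zero    = s≤s z≤n
n<r^n {r} 1<r (suc n) = begin-strict
    suc n       ≤⟨ n<r^n 1<r n ⟩
    r ^ n       <⟨ m<m*n (r ^ n) r {{m^n≢0 r n {{>-nonZero (<-trans (s≤s z≤n) 1<r)}}}} 1<r ⟩
    r ^ n * r   ≡⟨ *-comm (r ^ n) r ⟩
    r ^ suc n   ∎
  where open ≤-Reasoning

maxExp : ℕ → ℕ → ℕ → ℕ
maxExp r N zero    = 0
maxExp r N (suc f) with r ^ suc (maxExp r N f) ≤? N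
... | yes _ = suc (maxExp r N f)
... | no  _ = maxExp r N f

module _ {r N : ℕ} (1<r : 1 < r) (0<N : 0 < N) where

  private instance
    r≢0 : NonZero r
    r≢0 = >-nonZero (<-trans (s≤s z≤n) 1<r)

  maxExp-fits : ∀ f → r ^ maxExp r N f ≤ N
  maxExp-fits zero = 0<N
  maxExp-fits (suc f) with r ^ suc (maxExp r N f) ≤? N
  ... | yes fits = fits
  ... | no  _    = maxExp-fits f

  private
    lower : r ^ suc k ≤ N → r ^ k ≤ N
    lower {k} = ≤-trans (^-monoʳ-≤ r (n≤1+n k))

  maxExp-maximal : ∀ f {a} → a ≤ f → r ^ a ≤ N → a ≤ maxExp r N f
  maxExp-maximal zero    z≤n _ = z≤n
  maxExp-maximal (suc f) {a} a≤f+1 r^a≤N with r ^ suc (maxExp r N f) ≤? N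
  ... | yes _ with m≤n⇒m<n∨m≡n a≤f+1
  ...   | inj₁ a≤f  = m≤n⇒m≤1+n (maxExp-maximal f (s≤s⁻¹ a≤f) r^a≤N)
  ...   | inj₂ refl = s≤s (maxExp-maximal f ≤-refl (lower {f} r^a≤N))
  maxExp-maximal (suc f) {a} a≤f+1 r^a≤N | no ¬fits with a ≤? maxExp r N f
  ...   | yes a≤ = a≤
  ...   | no  a≰ = contradiction (≤-trans (^-monoʳ-≤ r (≰⇒> a≰)) r^a≤N) ¬fits

  -- With fuel N the search is exhaustive: every power of r up to N divides r ^ maxExp r N N.
  power∣maxPower : r ^ e ≤ N → r ^ e ∣ r ^ maxExp r N N
  power∣maxPower {e} r^e≤N = ^-monoʳ-∣ r (maxExp-maximal N (<⇒≤ (<-≤-trans (n<r^n 1<r e) r^e≤N)) r^e≤N)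

splitPower : 1 < r → ∀ j → 0 < j → ∃ λ a → ∃ λ s → j ≡ r ^ a * s × ¬ r ∣ s
splitPower {r} 1<r = <-rec (λ j → 0 < j → ∃ λ a → ∃ λ s → j ≡ r ^ a * s × ¬ r ∣ s) split
  where
  split : ∀ j → (∀ {i} → i < j → 0 < i → ∃ λ a → ∃ λ s → i ≡ r ^ a * s × ¬ r ∣ s) →
          0 < j → ∃ λ a → ∃ λ s → j ≡ r ^ a * s × ¬ r ∣ s
  split j smaller 0<j with r ∣? j
  ... | no r∤j = 0 , j , sym (+-identityʳ j) , r∤j
  ... | yes (divides zero j≡0) = contradiction j≡0 (>⇒≢ 0<j)
  ... | yes (divides (suc t) j≡t*r) = raise (smaller t<j (s≤s z≤n))
    where
    t<j : suc t < j
    t<j = subst (suc t <_) (sym j≡t*r) (m<m*n (suc t) r 1<r)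
    regroup : ∀ x s r → x * s * r ≡ r * x * s
    regroup = solve-∀
    raise : (∃ λ a → ∃ λ s → suc t ≡ r ^ a * s × ¬ r ∣ s) → ∃ λ a → ∃ λ s → j ≡ r ^ a * s × ¬ r ∣ s
    raise (a , s , t≡ , r∤s) = suc a , s , trans j≡t*r (trans (cong (_* r) t≡) (regroup (r ^ a) s r)) , r∤s

smoothPart : ℕ → List ℕ → ℕ
smoothPart N S = product (map (λ r → r ^ maxExp r N N) S)

smooth∣ : ∀ {N j} S → 0 < N → All Prime S → 0 < j → j ≤ N →
          (∀ {q} → Prime q → q ∣ j → q ∈ S) → j ∣ smoothPart N S
smooth∣ {j = j} [] _ _ 0<j _ factorsIn with factorise j {{>-nonZero 0<j}}
... | record { factors = [] ; isFactorisation = j≡1 } = ∣-reflexive j≡1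
... | record { factors = q ∷ qs ; isFactorisation = j≡ ; factorsPrime = pq ∷ _ }
  with () ← factorsIn pq (divides (product qs) (trans j≡ (*-comm q (product qs))))
smooth∣ {N} {j} (r ∷ S) 0<N (pr ∷ primeS) 0<j j≤N factorsIn
  with a , s , j≡ , r∤s ← splitPower (prime>1 pr) j 0<j =
  subst (_∣ smoothPart N (r ∷ S)) (sym j≡) (*-pres-∣ r^a∣ s∣)
  where
  instance _ = >-nonZero 0<j
  r^a∣ : r ^ a ∣ r ^ maxExp r N N
  r^a∣ = power∣maxPower (prime>1 pr) 0<N {a} (≤-trans (∣⇒≤ (divides s (trans j≡ (*-comm (r ^ a) s)))) j≤N)
  s∣j : s ∣ j
  s∣j = divides (r ^ a) j≡
  factorsIn′ : ∀ {q} → Prime q → q ∣ s → q ∈ S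
  factorsIn′ pq q∣s with factorsIn pq (∣-trans q∣s s∣j)
  ... | here refl = contradiction q∣s r∤s
  ... | there q∈S = q∈S
  0<s : 0 < s
  0<s = n≢0⇒n>0 (λ s≡0 → >⇒≢ 0<j (trans j≡ (trans (cong (r ^ a *_) s≡0) (*-zeroʳ (r ^ a)))))
  s∣ : s ∣ smoothPart N S
  s∣ = smooth∣ S 0<N primeS 0<s (≤-trans (∣⇒≤ s∣j) j≤N) factorsIn′

-- Each factor of smoothPart N S is at most N.
smoothPart-fits : ∀ {N} S → 0 < N → All Prime S → smoothPart N S ≤ N ^ length S
smoothPart-fits []      _   []           = ≤-refl
smoothPart-fits {N} (r ∷ S) 0<N (pr ∷ primeS) = *-mono-≤ (maxExp-fits (prime>1 pr) 0<N N) (smoothPart-fits S 0<N primeS)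

smoothPart≢0 : ∀ {N} S → All Prime S → NonZero (smoothPart N S)
smoothPart≢0 []      []            = _
smoothPart≢0 {N} (r ∷ S) (pr ∷ primeS) =
  m*n≢0 (r ^ maxExp r N N) (smoothPart N S) {{m^n≢0 r (maxExp r N N) {{prime⇒nonZero pr}}}} {{smoothPart≢0 {N} S primeS}}

-- Chebyshev-type bound: 2^n ≤ (n+1)^π(n+1), with π(n+1) = primesBelow (n + 2).  The product
-- of the largest prime powers ≤ n+1 is a common multiple of 1, …, n+1, at most (n+1)^π(n+1).
chebyshev : ∀ n → 2 ^ n ≤ suc n ^ primesBelow (n + 2)
chebyshev n = ≤-trans (commonMultiple≥2^ n (>-nonZero⁻¹ _ {{smoothPart≢0 {suc n} S primeS}}) multiple)
                      (smoothPart-fits S (s≤s z≤n) primeS)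
  where
  S = filter prime? (upTo (n + 2))
  primeS : All Prime S
  primeS = All.all-filter prime? (upTo (n + 2))
  multiple : CommonMultiple (suc n) (smoothPart (suc n) S)
  multiple {j} 0<j j≤n+1 = smooth∣ S (s≤s z≤n) primeS 0<j j≤n+1 (λ pq q∣j → ∈-filter⁺ prime? (∈-upTo⁺ (below q∣j)) pq)
    where
    below : ∀ {q} → q ∣ j → q < n + 2
    below q∣j = ≤-trans (s≤s (≤-trans (∣⇒≤ {{>-nonZero 0<j}} q∣j) j≤n+1)) (≤-reflexive (+-comm 2 n))

primesBelow-suc : ∀ n → primesBelow n ≤ primesBelow (suc n)
primesBelow-suc n = begin
    primesBelow n                                              ≤⟨ length-++-≤ˡ (filter prime? (upTo n)) ⟩
    length (filter prime? (upTo n) ++ filter prime? (n ∷ [])) ≡⟨ cong length (filter-++ prime? (upTo n) (n ∷ [])) ⟨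
    length (filter prime? (upTo n ++ n ∷ []))                  ≡⟨ cong (λ xs → length (filter prime? xs)) (upTo-∷ʳ n) ⟩
    primesBelow (suc n)                                        ∎
  where open ≤-Reasoning

primesBelow-mono : m ≤ n → primesBelow m ≤ primesBelow n
primesBelow-mono m≤n = mono (≤⇒≤′ m≤n)
  where
  mono : m ≤′ n → primesBelow m ≤ primesBelow n
  mono ≤′-refl        = ≤-refl
  mono {n = suc n} (≤′-step m≤′n) = ≤-trans (mono m≤′n) (primesBelow-suc n)

2^-cancel-≤ : 2 ^ m ≤ 2 ^ n → m ≤ n
2^-cancel-≤ 2^m≤2^n = ≮⇒≥ (λ n<m → <⇒≱ (^-monoʳ-< 2 (s≤s (s≤s z≤n)) n<m) 2^m≤2^n)

quadratic<2^ : ∀ r → 2 + (3 + r) * (1 + r) < 2 ^ (3 + r)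
quadratic<2^ zero    = toWitness {a? = 6 ≤? 8} _
quadratic<2^ (suc r) = begin-strict
    2 + (4 + r) * (2 + r)                   ≤⟨ m≤m+n _ (r * r + 2 * r) ⟩
    2 + (4 + r) * (2 + r) + (r * r + 2 * r) ≡⟨ expand r ⟩
    2 * (2 + (3 + r) * (1 + r))             <⟨ *-monoʳ-< 2 (quadratic<2^ r) ⟩
    2 ^ (4 + r)                             ∎
  where
  open ≤-Reasoning
  expand : ∀ r → 2 + (4 + r) * (2 + r) + (r * r + 2 * r) ≡ 2 * (2 + (3 + r) * (1 + r))
  expand = solve-∀

-- The i-th prime is below 2^(i+1) for i ≥ 2.  Otherwise, with N = 2^(i+1), all primes below N
-- are among the first i - 1, and Chebyshev's bound 2^(N-2) ≤ N^(i-1) contradicts quadratic<2^.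
ithPrime<2^ : ∀ {i p} → 1 < i → IsIthPrime i p → p < 2 ^ suc i
ithPrime<2^ {suc zero} (s≤s ()) _
ithPrime<2^ {suc (suc r)} {p} _ (_ , rank) with p <? 2 ^ (3 + r)
... | yes p<2^a = p<2^a
... | no  p≮2^a = contradiction (quadratic<2^ r) (≤⇒≯ (begin
    2 ^ a                ≡⟨ t+2≡2^a ⟨
    t + 2                ≤⟨ +-monoˡ-≤ 2 t≤aL ⟩
    a * L + 2            ≤⟨ +-monoˡ-≤ 2 (*-monoʳ-≤ a L≤r+1) ⟩
    a * (1 + r) + 2      ≡⟨ +-comm (a * (1 + r)) 2 ⟩
    2 + a * (1 + r)      ∎))
  where
  open ≤-Reasoning
  a = 3 + r
  t = 2 ^ a ∸ 2
  t+2≡2^a : t + 2 ≡ 2 ^ a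
  t+2≡2^a = m∸n+n≡m (^-monoʳ-≤ 2 {1} {a} (s≤s z≤n))
  L = primesBelow (2 ^ a)
  L≤r+1 : L ≤ 1 + r
  L≤r+1 = subst (L ≤_) (suc-injective rank) (primesBelow-mono (≮⇒≥ p≮2^a))
  t≤aL : t ≤ a * L
  t≤aL = 2^-cancel-≤ (begin
    2 ^ t                           ≤⟨ chebyshev t ⟩
    suc t ^ primesBelow (t + 2)     ≡⟨ cong (λ x → suc t ^ primesBelow x) t+2≡2^a ⟩
    suc t ^ L                       ≤⟨ ^-monoˡ-≤ L (subst (suc t ≤_) t+2≡2^a (≤-trans (n≤1+n (suc t)) (≤-reflexive (+-comm 2 t)))) ⟩
    (2 ^ a) ^ L                     ≡⟨ ^-*-assoc 2 a L ⟩
    2 ^ (a * L)                     ∎)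

oddPrime : Prime p → p ≢ 2 → ∃ λ q → p ≡ 1 + q * 2
oddPrime {p} pp p≢2 with p % 2 | m≡m%n+[m/n]*n p 2 | m%n<n p 2
... | 0 | p≡ | _ = contradiction (prime⇒irreducible pp (divides (p / 2) p≡)) λ where
  (inj₁ ())
  (inj₂ 2≡p) → p≢2 (sym 2≡p)
... | 1 | p≡ | _ = p / 2 , p≡
... | suc (suc _) | _ | s≤s (s≤s ())

mainTheorem13 : (i p : ℕ) → 1 < i → IsIthPrime i p → Zumkeller (2 ^ i * p)
mainTheorem13 i p 1<i ith@(pp , rank) =
  let q , p≡1+2q = oddPrime pp p≢2
  in OddPrimeTimesPowerOfTwo.zumkeller {i} {p} {q} pp p≡1+2q (ithPrime<2^ 1<i ith)
  where
  -- p₁ = 2 is excluded since i > 1.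
  p≢2 : p ≢ 2
  p≢2 refl = <⇒≢ 1<i rank
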